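{- Let $G$ be a finite connected simple graph on $n$ vertices having a universal vertex $v$ (adjacent to all other vertices) such that $G-v$ is connected. Then $\operatorname{mfgon}(G)=n-\alpha(G)$.
   Context: $\alpha(G)$ is the independence number of $G$ (maximum size of a set of pairwise non-adjacent vertices). A divisor is an integer combination $D=\sum_wD(w)(w)$ of vertices, degree $\sum_wD(w)$, effective if all $D(w)\ge0$. Divisors are equivalent if their difference lies in the integer column space of the Laplacian. The rank $r(D)$ is $-1$ if $D$ is not equivalent to an effective divisor, else the largest $r\ge0$ such that $D-E$ is equivalent to an effective divisor for all effective $E$ of degree $r$. $\operatorname{mfgon}(G)$ is the minimum degree of a positive-rank effective divisor $D$ with $D(w)\le1$ for all $w$. -}

module Defs where

open import Data.Nat as ℕ using (ℕ; zero; suc)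
open import Data.Integer as ℤ using (ℤ; +_; -[1+_]; _+_; _-_; _*_; _≤_; _<_)
open import Data.Fin using (Fin; zero; suc)
open import Data.Fin.Subset using (Subset; _∈_; ∣_∣)
open import Data.Bool using (Bool; true; false)
open import Data.Sum using (_⊎_)
open import Data.Product using (Σ; ∃; _×_; _,_)
open import Relation.Binary.PropositionalEquality using (_≡_; _≢_)
open import Relation.Nullary using (¬_)

record SimpleGraph (n : ℕ) : Set where
  field
    adj    : Fin n → Fin n → Bool
    sym    : ∀ u w → adj u w ≡ adj w u
    irrefl : ∀ u → adj u u ≡ false
open SimpleGraph public

Σℤ : (n : ℕ) → (Fin n → ℤ) → ℤ
Σℤ zero    f = + 0
Σℤ (suc n) f = f zero + Σℤ n (λ i → f (suc i))

b2ℤ : Bool → ℤ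
b2ℤ true  = + 1
b2ℤ false = + 0

module _ {n : ℕ} (G : SimpleGraph n) where

  data Reach : Fin n → Fin n → Set where
    here : ∀ u → Reach u u
    step : ∀ {u x w} → adj G u x ≡ true → Reach x w → Reach u w

  Connected : Set
  Connected = ∀ u w → Reach u w

  -- walks in G - v (all vertices of the walk differ from v)
  data ReachAvoid (v : Fin n) : Fin n → Fin n → Set where
    here : ∀ u → u ≢ v → ReachAvoid v u u
    step : ∀ {u x w} → u ≢ v → adj G u x ≡ true → ReachAvoid v x w → ReachAvoid v u w

  -- G - v is connected (and nonempty, i.e. has a vertex other than v)
  ConnectedMinus : Fin n → Set
  ConnectedMinus v = (∃ λ u → u ≢ v) × (∀ u w → u ≢ v → w ≢ v → ReachAvoid v u w)

  Universal : Fin n → Set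
  Universal v = ∀ w → w ≢ v → adj G v w ≡ true

  Independent : Subset n → Set
  Independent S = ∀ u w → u ∈ S → w ∈ S → adj G u w ≡ false

  IsIndependenceNumber : ℕ → Set
  IsIndependenceNumber a =
    (Σ (Subset n) λ S → Independent S × ∣ S ∣ ≡ a) ×
    (∀ S → Independent S → ∣ S ∣ ℕ.≤ a)

  Divisor : Set
  Divisor = Fin n → ℤ

  deg : Divisor → ℤ
  deg D = Σℤ n D

  Effective : Divisor → Set
  Effective D = ∀ w → + 0 ≤ D w

  Lap : (Fin n → ℤ) → Divisor
  Lap f w = Σℤ n (λ u → b2ℤ (adj G w u) * (f w - f u))

  _∼_ : Divisor → Divisor → Set
  D ∼ D' = ∃ λ (f : Fin n → ℤ) → ∀ w → D w - D' w ≡ Lap f w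

  EquivEffective : Divisor → Set
  EquivEffective D = ∃ λ F → Effective F × D ∼ F

  RankAtLeast : Divisor → ℕ → Set
  RankAtLeast D r = ∀ E → Effective E → deg E ≡ + r → EquivEffective (λ w → D w - E w)

  IsRank : Divisor → ℤ → Set
  IsRank D rk =
    (¬ EquivEffective D × rk ≡ -[1+ 0 ]) ⊎
    (EquivEffective D × Σ ℕ λ r → rk ≡ + r × RankAtLeast D r × ¬ RankAtLeast D (suc r))

  MfgonCandidate : Divisor → Set
  MfgonCandidate D = Effective D × (∀ w → D w ≤ + 1) × (∃ λ rk → IsRank D rk × + 0 < rk)

  IsMfgon : ℕ → Set
  IsMfgon k =
    (Σ Divisor λ D → MfgonCandidate D × deg D ≡ + k) ×
    (∀ D → MfgonCandidate D → + k ≤ deg D)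

-- For a maximum independent set S avoiding v, the indicator of the complement of S is a 0/1
-- divisor of degree n - α(G) and rank exactly 1: a chip taken from w ∈ S is recovered by
-- letting w borrow one chip from each neighbour, none of which lies in S. Conversely, the zero
-- set of a 0/1 divisor of positive rank is independent, so its degree is at least n - α(G).
-- Both rank statements rest on one observation: if D' is equivalent to an effective divisor,
-- then Lap f ≤ D' for some f, and a vertex where f is maximal has Laplacian at least its
-- number of neighbours off the maximum. When D' ≤ 1, as v sees every vertex and G - v is
-- connected, f is then maximal at v or on all of G - v; neither is possible if two adjacent
-- vertices carry D' < 0 and D' ≤ 0.
module Submission where

open import Defs
open import Data.Nat using (ℕ; _∸_)
open import Data.Fin using (Fin; zero; suc; _≟_)

open import Data.Bool using (true; false)
open import Data.Empty using (⊥; ⊥-elim)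
open import Data.Fin.Properties using (any?; suc-injective)
open import Data.Fin.Subset using (Subset; ∣_∣; ⁅_⁆; _∈_; _∉_; _⊆_; ∁; Nonempty)
open import Data.Fin.Subset.Properties
  using (_∈?_; nonempty?; Empty-unique; ∣⊥∣≡0; x∈⁅x⁆; x∈⁅y⁆⇒x≡y; ∣⁅x⁆∣≡1; p⊆q⇒∣p∣≤∣q∣;
         ∣∁p∣≡n∸∣p∣; x∈p⇒x∉∁p; x∉p⇒x∈∁p)
open import Data.Integer as ℤ using (ℤ; +_; -[1+_]; _+_; _-_; _*_; -_; _≤_; _<_; +≤+; -≤+; +<+; -<+)
open import Data.Integer.Properties hiding (_≟_)
open import Data.Integer.Tactic.RingSolver using (solve-∀)
import Data.Nat as ℕ
import Data.Nat.Properties as ℕ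
open import Data.Product using (Σ; ∃; ∃₂; _×_; _,_; proj₁; proj₂)
open import Data.Sum using (_⊎_; inj₁; inj₂)
open import Data.Vec using (_∷_; []; lookup; tabulate)
open import Data.Vec.Properties using (lookup∘tabulate; []=⇒lookup; lookup⇒[]=)
open import Function using (_∘_; _$_)
open import Relation.Nullary using (¬_; Dec; yes; no; does; ¬?; contradiction)
open import Relation.Nullary.Decidable using (dec-true; decidable-stable)
open import Relation.Binary.PropositionalEquality
  using (_≡_; _≢_; refl; trans; cong; cong₂; subst; subst₂) renaming (sym to ≡-sym)

nonneg∧≢0⇒1≤ : ∀ {i} → + 0 ≤ i → i ≢ + 0 → + 1 ≤ i
nonneg∧≢0⇒1≤ 0≤i i≢0 = i<j⇒suc[i]≤j (≤∧≢⇒< 0≤i (i≢0 ∘ ≡-sym))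

+[1+n]≰+n : ∀ n → ¬ (+ ℕ.suc n ≤ + n)
+[1+n]≰+n n = ℕ.1+n≰n ∘ drop‿+≤+

0≤j⇒i-j≤i : ∀ i {j} → + 0 ≤ j → i - j ≤ i
0≤j⇒i-j≤i i 0≤j = subst (i - _ ≤_) (+-identityʳ i) (+-monoʳ-≤ i (neg-mono-≤ 0≤j))

b2ℤ-nonneg : ∀ b → + 0 ≤ b2ℤ b
b2ℤ-nonneg true  = +≤+ ℕ.z≤n
b2ℤ-nonneg false = +≤+ ℕ.z≤n

b2ℤ≤1 : ∀ b → b2ℤ b ≤ + 1
b2ℤ≤1 true  = +≤+ (ℕ.s≤s ℕ.z≤n)
b2ℤ≤1 false = +≤+ ℕ.z≤n

b2ℤ*-nonneg : ∀ b {z} → + 0 ≤ z → + 0 ≤ b2ℤ b * z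
b2ℤ*-nonneg true  {z} 0≤z = subst (+ 0 ≤_) (≡-sym (*-identityˡ z)) 0≤z
b2ℤ*-nonneg false     _   = ≤-refl

b2ℤ*-nonpos : ∀ b {z} → z ≤ + 0 → b2ℤ b * z ≤ + 0
b2ℤ*-nonpos true  {z} z≤0 = subst (_≤ + 0) (≡-sym (*-identityˡ z)) z≤0
b2ℤ*-nonpos false     _   = ≤-refl

Σℤ-cong : ∀ n {f g : Fin n → ℤ} → (∀ i → f i ≡ g i) → Σℤ n f ≡ Σℤ n g
Σℤ-cong ℕ.zero    f≗g = refl
Σℤ-cong (ℕ.suc n) f≗g = cong₂ _+_ (f≗g zero) (Σℤ-cong n (f≗g ∘ suc))

Σℤ-zero : ∀ n → Σℤ n (λ _ → + 0) ≡ + 0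
Σℤ-zero ℕ.zero    = refl
Σℤ-zero (ℕ.suc n) = trans (+-identityˡ _) (Σℤ-zero n)

Σℤ-distrib-+ : ∀ n (f g : Fin n → ℤ) → Σℤ n (λ i → f i + g i) ≡ Σℤ n f + Σℤ n g
Σℤ-distrib-+ ℕ.zero    f g = refl
Σℤ-distrib-+ (ℕ.suc n) f g =
  trans (cong (_+_ (f zero + g zero)) (Σℤ-distrib-+ n (f ∘ suc) (g ∘ suc)))
        (swap (f zero) (g zero) _ _)
  where
  swap : ∀ a b c d → (a + b) + (c + d) ≡ (a + c) + (b + d)
  swap = solve-∀

Σℤ-nonneg : ∀ n {g : Fin n → ℤ} → (∀ i → + 0 ≤ g i) → + 0 ≤ Σℤ n g
Σℤ-nonneg ℕ.zero    g≥0 = ≤-refl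
Σℤ-nonneg (ℕ.suc n) g≥0 = +-mono-≤ (g≥0 zero) (Σℤ-nonneg n (g≥0 ∘ suc))

Σℤ-nonpos : ∀ n {g : Fin n → ℤ} → (∀ i → g i ≤ + 0) → Σℤ n g ≤ + 0
Σℤ-nonpos ℕ.zero    g≤0 = ≤-refl
Σℤ-nonpos (ℕ.suc n) g≤0 = +-mono-≤ (g≤0 zero) (Σℤ-nonpos n (g≤0 ∘ suc))

term≤Σℤ : ∀ n (g : Fin n → ℤ) i → (∀ j → j ≢ i → + 0 ≤ g j) → g i ≤ Σℤ n g
term≤Σℤ (ℕ.suc n) g zero g≥0 =
  subst (_≤ Σℤ (ℕ.suc n) g) (+-identityʳ (g zero))
    (+-monoʳ-≤ (g zero) (Σℤ-nonneg n (λ j → g≥0 (suc j) λ ())))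
term≤Σℤ (ℕ.suc n) g (suc i) g≥0 =
  subst (_≤ Σℤ (ℕ.suc n) g) (+-identityˡ (g (suc i))) $
  +-mono-≤ (g≥0 zero λ ()) (term≤Σℤ n (g ∘ suc) i (λ j j≢i → g≥0 (suc j) (j≢i ∘ suc-injective)))

Σℤ≤term : ∀ n (g : Fin n → ℤ) i → (∀ j → j ≢ i → g j ≤ + 0) → Σℤ n g ≤ g i
Σℤ≤term (ℕ.suc n) g zero g≤0 =
  subst (Σℤ (ℕ.suc n) g ≤_) (+-identityʳ (g zero))
    (+-monoʳ-≤ (g zero) (Σℤ-nonpos n (λ j → g≤0 (suc j) λ ())))
Σℤ≤term (ℕ.suc n) g (suc i) g≤0 =
  subst (Σℤ (ℕ.suc n) g ≤_) (+-identityˡ (g (suc i))) $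
  +-mono-≤ (g≤0 zero λ ()) (Σℤ≤term n (g ∘ suc) i (λ j j≢i → g≤0 (suc j) (j≢i ∘ suc-injective)))

term+term≤Σℤ : ∀ n (g : Fin n → ℤ) {i j} → i ≢ j → (∀ k → + 0 ≤ g k) → g i + g j ≤ Σℤ n g
term+term≤Σℤ (ℕ.suc n) g {zero}  {zero}  i≢j g≥0 = contradiction refl i≢j
term+term≤Σℤ (ℕ.suc n) g {zero}  {suc j} i≢j g≥0 =
  +-monoʳ-≤ (g zero) (term≤Σℤ n (g ∘ suc) j (λ k _ → g≥0 (suc k)))
term+term≤Σℤ (ℕ.suc n) g {suc i} {zero}  i≢j g≥0 =
  subst (_≤ Σℤ (ℕ.suc n) g) (+-comm (g zero) (g (suc i)))
    (+-monoʳ-≤ (g zero) (term≤Σℤ n (g ∘ suc) i (λ k _ → g≥0 (suc k))))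
term+term≤Σℤ (ℕ.suc n) g {suc i} {suc j} i≢j g≥0 =
  subst (_≤ Σℤ (ℕ.suc n) g) (+-identityˡ (g (suc i) + g (suc j))) $
  +-mono-≤ (g≥0 zero) (term+term≤Σℤ n (g ∘ suc) (i≢j ∘ cong suc) (g≥0 ∘ suc))

𝟙 : ∀ {n} → Subset n → Fin n → ℤ
𝟙 S x = b2ℤ (lookup S x)

𝟙-nonneg : ∀ {n} (S : Subset n) x → + 0 ≤ 𝟙 S x
𝟙-nonneg S x = b2ℤ-nonneg (lookup S x)

𝟙≤1 : ∀ {n} (S : Subset n) x → 𝟙 S x ≤ + 1
𝟙≤1 S x = b2ℤ≤1 (lookup S x)

𝟙-∈ : ∀ {n} {S : Subset n} {x} → x ∈ S → 𝟙 S x ≡ + 1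
𝟙-∈ x∈S = cong b2ℤ ([]=⇒lookup x∈S)

𝟙-∉ : ∀ {n} {S : Subset n} {x} → x ∉ S → 𝟙 S x ≡ + 0
𝟙-∉ {S = S} {x} x∉S with lookup S x in eq
... | true  = contradiction (lookup⇒[]= x S eq) x∉S
... | false = refl

Σℤ-𝟙 : ∀ {n} (S : Subset n) → Σℤ n (𝟙 S) ≡ + ∣ S ∣
Σℤ-𝟙 []          = refl
Σℤ-𝟙 (true  ∷ S) = cong (_+_ (+ 1)) (Σℤ-𝟙 S)
Σℤ-𝟙 (false ∷ S) = trans (+-identityˡ _) (Σℤ-𝟙 S)

deg-𝟙∁ : ∀ {n} (S : Subset n) → Σℤ n (𝟙 (∁ S)) ≡ + (n ∸ ∣ S ∣)
deg-𝟙∁ S = trans (Σℤ-𝟙 (∁ S)) (cong +_ (∣∁p∣≡n∸∣p∣ S))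

1≤∣S∣⇒nonempty : ∀ {n} (S : Subset n) → 1 ℕ.≤ ∣ S ∣ → Nonempty S
1≤∣S∣⇒nonempty {n} S 1≤∣S∣ with nonempty? S
... | yes S≠∅ = S≠∅
... | no  S=∅ = contradiction (trans (cong ∣_∣ (Empty-unique S=∅)) (∣⊥∣≡0 n)) (ℕ.>⇒≢ 1≤∣S∣)

δ : ∀ {n} → Fin n → Fin n → ℤ
δ w = 𝟙 ⁅ w ⁆

δ-nonneg : ∀ {n} (w x : Fin n) → + 0 ≤ δ w x
δ-nonneg w = 𝟙-nonneg ⁅ w ⁆

δ-self : ∀ {n} (w : Fin n) → δ w w ≡ + 1
δ-self w = 𝟙-∈ (x∈⁅x⁆ w)

δ-other : ∀ {n} {w x : Fin n} → x ≢ w → δ w x ≡ + 0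
δ-other {w = w} x≢w = 𝟙-∉ (x≢w ∘ x∈⁅y⁆⇒x≡y w)

Σℤ-δ : ∀ n (w : Fin n) → Σℤ n (δ w) ≡ + 1
Σℤ-δ n w = trans (Σℤ-𝟙 ⁅ w ⁆) (cong +_ (∣⁅x⁆∣≡1 w))

effective-deg1⇒δ : ∀ n (E : Fin n → ℤ) → (∀ x → + 0 ≤ E x) → Σℤ n E ≡ + 1 →
                   ∃ λ w → ∀ x → E x ≡ δ w x
effective-deg1⇒δ n E E≥0 ΣE≡1 with any? (λ x → ¬? (E x ℤ.≟ + 0))
... | no ∄ = contradiction (trans (≡-sym (trans (Σℤ-cong n E≡0) (Σℤ-zero n))) ΣE≡1) λ ()
  where
  E≡0 : ∀ x → E x ≡ + 0
  E≡0 x = decidable-stable (E x ℤ.≟ + 0) (λ Ex≢0 → ∄ (x , Ex≢0))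
... | yes (w , Ew≢0) = w , E≡δ
  where
  1≤Ew : + 1 ≤ E w
  1≤Ew = nonneg∧≢0⇒1≤ (E≥0 w) Ew≢0

  E≡δ : ∀ x → E x ≡ δ w x
  E≡δ x with x ≟ w | E x ℤ.≟ + 0
  ... | yes refl | _ = trans (≤-antisym Ew≤1 1≤Ew) (≡-sym (δ-self w))
    where Ew≤1 = subst (E w ≤_) ΣE≡1 (term≤Σℤ n E w (λ j _ → E≥0 j))
  ... | no x≢w | yes Ex≡0 = trans Ex≡0 (≡-sym (δ-other x≢w))
  ... | no x≢w | no Ex≢0 = contradiction (subst (+ 2 ≤_) ΣE≡1 2≤ΣE) (+[1+n]≰+n 1)
    where
    2≤ΣE = ≤-trans (+-mono-≤ (nonneg∧≢0⇒1≤ (E≥0 x) Ex≢0) 1≤Ew)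
                   (term+term≤Σℤ n E x≢w E≥0)

argmax : ∀ {n} → Fin n → (f : Fin n → ℤ) → ∃ λ x → ∀ y → f y ≤ f x
argmax {ℕ.suc ℕ.zero}     _ f = zero , λ { zero → ≤-refl }
argmax {ℕ.suc (ℕ.suc k)} _ f with argmax zero (f ∘ suc)
... | x , fx-max with f zero ≤? f (suc x)
...   | yes f0≤fx = suc x , λ { zero → f0≤fx ; (suc y) → fx-max y }
...   | no  f0≰fx = zero , λ { zero → ≤-refl ; (suc y) → ≤-trans (fx-max y) (<⇒≤ (≰⇒> f0≰fx)) }

zeros : ∀ {n} → (Fin n → ℤ) → Subset n
zeros D = tabulate (λ x → does (D x ℤ.≟ + 0))

∈zeros⇒≡0 : ∀ {n} (D : Fin n → ℤ) {x} → x ∈ zeros D → D x ≡ + 0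
∈zeros⇒≡0 D {x} x∈Z with D x ℤ.≟ + 0 | trans (≡-sym (lookup∘tabulate _ x)) ([]=⇒lookup x∈Z)
... | yes Dx≡0 | _  = Dx≡0
... | no  _    | ()

≡0⇒∈zeros : ∀ {n} (D : Fin n → ℤ) {x} → D x ≡ + 0 → x ∈ zeros D
≡0⇒∈zeros D {x} Dx≡0 =
  lookup⇒[]= x (zeros D) (trans (lookup∘tabulate _ x) (dec-true (D x ℤ.≟ + 0) Dx≡0))

01-valued≡𝟙∁zeros : ∀ {n} (D : Fin n → ℤ) → (∀ x → + 0 ≤ D x) → (∀ x → D x ≤ + 1) →
                    ∀ x → D x ≡ 𝟙 (∁ (zeros D)) x
01-valued≡𝟙∁zeros D D≥0 D≤1 x with D x ℤ.≟ + 0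
... | yes Dx≡0 = trans Dx≡0 (≡-sym (𝟙-∉ (x∈p⇒x∉∁p (≡0⇒∈zeros D Dx≡0))))
... | no  Dx≢0 = trans (≤-antisym (D≤1 x) (nonneg∧≢0⇒1≤ (D≥0 x) Dx≢0))
                       (≡-sym (𝟙-∈ (x∉p⇒x∈∁p (Dx≢0 ∘ ∈zeros⇒≡0 D))))

module _ {n : ℕ} (G : SimpleGraph n) where

  Lap-const : ∀ c x → Lap G (λ _ → c) x ≡ + 0
  Lap-const c x = trans (Σℤ-cong n term≡0) (Σℤ-zero n)
    where
    term≡0 : ∀ u → b2ℤ (adj G x u) * (c - c) ≡ + 0
    term≡0 u = trans (cong (b2ℤ (adj G x u) *_) (+-inverseʳ c)) (*-zeroʳ (b2ℤ (adj G x u)))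

  EquivEffective-cong : ∀ {D D' : Divisor G} → (∀ x → D x ≡ D' x) → EquivEffective G D →
                        EquivEffective G D'
  EquivEffective-cong D≗D' (F , F≥0 , f , eq) =
    F , F≥0 , f , λ x → trans (cong (_- F x) (≡-sym (D≗D' x))) (eq x)

  Lap≤⇒equivEffective : ∀ {D : Divisor G} f → (∀ x → Lap G f x ≤ D x) → EquivEffective G D
  Lap≤⇒equivEffective {D} f Lap≤D =
    (λ x → D x - Lap G f x) , (λ x → i≤j⇒0≤j-i (Lap≤D x)) , f , (λ x → cancel (D x) (Lap G f x))
    where
    cancel : ∀ a b → a - (a - b) ≡ b
    cancel = solve-∀

  equivEffective⇒Lap≤ : ∀ {D : Divisor G} → EquivEffective G D → ∃ λ f → ∀ x → Lap G f x ≤ D x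
  equivEffective⇒Lap≤ {D} (F , F≥0 , f , D-F≡Lap) =
    f , λ x → subst (_≤ D x) (D-F≡Lap x) (0≤j⇒i-j≤i (D x) (F≥0 x))

  effective⇒equivEffective : ∀ {D : Divisor G} → Effective G D → EquivEffective G D
  effective⇒equivEffective {D} D≥0 =
    Lap≤⇒equivEffective (λ _ → + 0) (λ x → subst (_≤ D x) (≡-sym (Lap-const (+ 0) x)) (D≥0 x))

  RankAtLeast-pred : ∀ (D : Divisor G) {k} → Fin n → RankAtLeast G D (ℕ.suc k) → RankAtLeast G D k
  RankAtLeast-pred D {k} w rank E E≥0 degE≡k
    with rank (λ x → E x + δ w x) (λ x → +-mono-≤ (E≥0 x) (δ-nonneg w x)) degE+w≡1+k
    where
    degE+w≡1+k : deg G (λ x → E x + δ w x) ≡ + ℕ.suc k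
    degE+w≡1+k = trans (Σℤ-distrib-+ n E (δ w))
                       (trans (cong₂ _+_ degE≡k (Σℤ-δ n w)) (cong +_ (ℕ.+-comm k 1)))
  ... | F , F≥0 , f , eq =
    (λ x → F x + δ w x) , (λ x → +-mono-≤ (F≥0 x) (δ-nonneg w x)) , f ,
    (λ x → trans (shift (D x) (E x) (F x) (δ w x)) (eq x))
    where
    shift : ∀ d e f t → (d - e) - (f + t) ≡ (d - (e + t)) - f
    shift = solve-∀

  RankAtLeast-suc⇒1 : ∀ (D : Divisor G) k → Fin n → RankAtLeast G D (ℕ.suc k) → RankAtLeast G D 1
  RankAtLeast-suc⇒1 D ℕ.zero    w rank = rank
  RankAtLeast-suc⇒1 D (ℕ.suc k) w rank = RankAtLeast-suc⇒1 D k w (RankAtLeast-pred D w rank)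

  positiveRank⇒RankAtLeast1 : ∀ (D : Divisor G) {rk} → Fin n → IsRank G D rk → + 0 < rk →
                              RankAtLeast G D 1
  positiveRank⇒RankAtLeast1 D w (inj₁ (_ , refl))                      ()
  positiveRank⇒RankAtLeast1 D w (inj₂ (_ , ℕ.zero  , refl , _    , _)) (+<+ ())
  positiveRank⇒RankAtLeast1 D w (inj₂ (_ , ℕ.suc r , refl , rank , _)) _ =
    RankAtLeast-suc⇒1 D r w rank

  Independent-⁅⁆ : ∀ x → Independent G ⁅ x ⁆
  Independent-⁅⁆ x u w u∈ w∈ =
    trans (cong₂ (adj G) (x∈⁅y⁆⇒x≡y x u∈) (x∈⁅y⁆⇒x≡y x w∈)) (SimpleGraph.irrefl G x)

  adj⇒≢ : ∀ {x y} → adj G x y ≡ true → x ≢ y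
  adj⇒≢ {x} xy refl with () ← trans (≡-sym xy) (SimpleGraph.irrefl G x)

  -- D ~ D - Lap f; for f = - δ w this lets w borrow one chip from each of its neighbours.
  Lap-borrow-other : ∀ {w x} → x ≢ w → Lap G (λ y → - δ w y) x ≤ b2ℤ (adj G x w)
  Lap-borrow-other {w} {x} x≢w =
    ≤-trans (Σℤ≤term n _ w other≤0) (≤-reflexive (trans (cong (λ t → b2ℤ (adj G x w) * t) at-w)
                                                         (*-identityʳ _)))
    where
    other≤0 : ∀ u → u ≢ w → b2ℤ (adj G x u) * (- δ w x - - δ w u) ≤ + 0
    other≤0 u u≢w rewrite δ-other x≢w | δ-other u≢w | *-zeroʳ (b2ℤ (adj G x u)) = ≤-refl
    at-w : - δ w x - - δ w w ≡ + 1
    at-w rewrite δ-other x≢w | δ-self w = refl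

  Lap-borrow-self : ∀ {w u} → adj G w u ≡ true → Lap G (λ y → - δ w y) w ≤ -[1+ 0 ]
  Lap-borrow-self {w} {u} wu = ≤-trans (Σℤ≤term n _ u term≤0) (≤-reflexive at-u)
    where
    term : Fin n → ℤ
    term y = b2ℤ (adj G w y) * (- δ w w - - δ w y)
    term≤0 : ∀ y → y ≢ u → term y ≤ + 0
    term≤0 y _ with y ≟ w
    ... | yes refl rewrite SimpleGraph.irrefl G w = ≤-refl
    ... | no y≢w rewrite δ-self w | δ-other y≢w = b2ℤ*-nonpos (adj G w y) -≤+
    at-u : term u ≡ -[1+ 0 ]
    at-u rewrite wu | δ-self w | δ-other (adj⇒≢ wu ∘ ≡-sym) = refl

  ReachAvoid-source≢ : ∀ {v x y} → ReachAvoid G v x y → x ≢ v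
  ReachAvoid-source≢ (here _ x≢v)     = x≢v
  ReachAvoid-source≢ (step x≢v _ _)   = x≢v

  ReachAvoid-exit : ∀ {v x y} (P : Fin n → Set) → (∀ z → Dec (P z)) → ReachAvoid G v x y →
                    P x → ¬ P y → ∃₂ λ a b → adj G a b ≡ true × P a × ¬ P b × a ≢ v × b ≢ v
  ReachAvoid-exit P P? (here _ _) Px ¬Py = contradiction Px ¬Py
  ReachAvoid-exit P P? (step {u} {x'} u≢v ux' walk) Pu ¬Py with P? x'
  ... | yes Px' = ReachAvoid-exit P P? walk Px' ¬Py
  ... | no ¬Px' = u , x' , ux' , Pu , ¬Px' , u≢v , ReachAvoid-source≢ walk

  module AtMaximum (f : Fin n → ℤ) {m : ℤ} (f≤m : ∀ y → f y ≤ m) where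

    private
      term : Fin n → Fin n → ℤ
      term a u = b2ℤ (adj G a u) * (f a - f u)

      term-nonneg : ∀ {a} → f a ≡ m → ∀ u → + 0 ≤ term a u
      term-nonneg {a} fa≡m u =
        b2ℤ*-nonneg (adj G a u) (i≤j⇒0≤j-i (subst (f u ≤_) (≡-sym fa≡m) (f≤m u)))

      term-pos : ∀ {a b} → f a ≡ m → adj G a b ≡ true → f b ≢ m → + 1 ≤ term a b
      term-pos {a} {b} fa≡m ab fb≢m rewrite ab | *-identityˡ (f a - f b) =
        nonneg∧≢0⇒1≤ (i≤j⇒0≤j-i (subst (f b ≤_) (≡-sym fa≡m) (f≤m b)))
                     (λ d≡0 → fb≢m (trans (≡-sym (i-j≡0⇒i≡j (f a) (f b) d≡0)) fa≡m))

    0≤Lap : ∀ {a} → f a ≡ m → + 0 ≤ Lap G f a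
    0≤Lap fa≡m = Σℤ-nonneg n (term-nonneg fa≡m)

    1≤Lap : ∀ {a b} → f a ≡ m → adj G a b ≡ true → f b ≢ m → + 1 ≤ Lap G f a
    1≤Lap {a} {b} fa≡m ab fb≢m =
      ≤-trans (term-pos fa≡m ab fb≢m) (term≤Σℤ n (term a) b (λ j _ → term-nonneg fa≡m j))

    2≤Lap : ∀ {a b c} → f a ≡ m → adj G a b ≡ true → adj G a c ≡ true → b ≢ c →
            f b ≢ m → f c ≢ m → + 2 ≤ Lap G f a
    2≤Lap {a} fa≡m ab ac b≢c fb≢m fc≢m =
      ≤-trans (+-mono-≤ (term-pos fa≡m ab fb≢m) (term-pos fa≡m ac fc≢m))
              (term+term≤Σℤ n (term a) b≢c (term-nonneg fa≡m))

module _ {n : ℕ} {G : SimpleGraph n} {v : Fin n}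
         (universal : Universal G v) (connected : ConnectedMinus G v) where

  adj-v : ∀ {x} → x ≢ v → adj G x v ≡ true
  adj-v x≢v = trans (SimpleGraph.sym G _ v) (universal _ x≢v)

  Lap≤1⇒max-at-v⊎max-off-v : ∀ (f : Fin n → ℤ) {m xs} → (∀ y → f y ≤ m) → f xs ≡ m →
                             (∀ x → Lap G f x ≤ + 1) → f v ≡ m ⊎ (∀ y → y ≢ v → f y ≡ m)
  Lap≤1⇒max-at-v⊎max-off-v f {m} {xs} f≤m fxs≡m Lap≤1 with f v ℤ.≟ m
  ... | yes fv≡m = inj₁ fv≡m
  ... | no  fv≢m = inj₂ λ y y≢v → decidable-stable (f y ℤ.≟ m) (¬off-max y y≢v)
    where
    open AtMaximum G f f≤m

    xs≢v : xs ≢ v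
    xs≢v refl = fv≢m fxs≡m

    ¬off-max : ∀ y → y ≢ v → ¬ f y ≢ m
    ¬off-max y y≢v fy≢m
      with ReachAvoid-exit G (λ z → f z ≡ m) (λ z → f z ℤ.≟ m)
             (proj₂ connected xs y xs≢v y≢v) fxs≡m fy≢m
    ... | a , b , ab , fa≡m , fb≢m , a≢v , b≢v =
      +[1+n]≰+n 1 (≤-trans (2≤Lap fa≡m ab (adj-v a≢v) b≢v fb≢m fv≢m) (Lap≤1 a))

  adjacent-deficit⇒¬equivEffective : ∀ {D : Divisor G} {x y} → (∀ z → D z ≤ + 1) →
                                     adj G x y ≡ true → D x < + 0 → D y ≤ + 0 → ¬ EquivEffective G D
  adjacent-deficit⇒¬equivEffective {D} {x} {y} D≤1 xy Dx<0 Dy≤0 D~F =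
    conclude (Lap≤1⇒max-at-v⊎max-off-v f f≤m refl (λ z → ≤-trans (Lap≤D z) (D≤1 z)))
    where
    f = proj₁ (equivEffective⇒Lap≤ G {D} D~F)
    Lap≤D = proj₂ (equivEffective⇒Lap≤ G {D} D~F)
    m = f (proj₁ (argmax v f))
    f≤m = proj₂ (argmax v f)
    open AtMaximum G f f≤m

    fx≢m : f x ≢ m
    fx≢m fx≡m = <⇒≱ Dx<0 (≤-trans (0≤Lap fx≡m) (Lap≤D x))

    fy≢m : f y ≢ m
    fy≢m fy≡m = +[1+n]≰+n 0
      (≤-trans (1≤Lap fy≡m (trans (SimpleGraph.sym G y x) xy) fx≢m) (≤-trans (Lap≤D y) Dy≤0))

    x≢y : x ≢ y
    x≢y = adj⇒≢ G xy

    conclude : f v ≡ m ⊎ (∀ z → z ≢ v → f z ≡ m) → ⊥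
    conclude (inj₁ fv≡m) =
      +[1+n]≰+n 1 (≤-trans (2≤Lap fv≡m (universal x x≢v) (universal y y≢v) x≢y fx≢m fy≢m)
                           (≤-trans (Lap≤D v) (D≤1 v)))
      where
      x≢v : x ≢ v
      x≢v refl = fx≢m fv≡m
      y≢v : y ≢ v
      y≢v refl = fy≢m fv≡m
    conclude (inj₂ max-off-v) with x ≟ v
    ... | yes refl = fy≢m (max-off-v y (x≢y ∘ ≡-sym))
    ... | no  x≢v  = fx≢m (max-off-v x x≢v)

  RankAtLeast1⇒zeros-independent : ∀ {D : Divisor G} → (∀ z → D z ≤ + 1) → RankAtLeast G D 1 →
                                   Independent G (zeros D)
  RankAtLeast1⇒zeros-independent {D} D≤1 rank u w u∈Z w∈Z with adj G u w in uw
  ... | false = refl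
  ... | true  = ⊥-elim (adjacent-deficit⇒¬equivEffective D'≤1 (trans (SimpleGraph.sym G w u) uw)
                         D'w<0 D'u≤0 (rank (δ w) (δ-nonneg w) (Σℤ-δ n w)))
    where
    D' : Divisor G
    D' z = D z - δ w z
    D'≤1 : ∀ z → D' z ≤ + 1
    D'≤1 z = ≤-trans (0≤j⇒i-j≤i (D z) (δ-nonneg w z)) (D≤1 z)
    D'w<0 : D' w < + 0
    D'w<0 rewrite ∈zeros⇒≡0 D w∈Z | δ-self w = -<+
    D'u≤0 : D' u ≤ + 0
    D'u≤0 rewrite ∈zeros⇒≡0 D u∈Z | δ-other (adj⇒≢ G uw) = ≤-refl

  ¬RankAtLeast2 : ∀ {D : Divisor G} {s} → (∀ z → D z ≤ + 1) → s ≢ v → D s ≡ + 0 →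
                  ¬ RankAtLeast G D 2
  ¬RankAtLeast2 {D} {s} D≤1 s≢v Ds≡0 rank =
    adjacent-deficit⇒¬equivEffective D'≤1 (adj-v s≢v) D's<0 D'v≤0 (rank E E≥0 degE≡2)
    where
    E : Divisor G
    E z = δ s z + δ v z
    E≥0 : Effective G E
    E≥0 z = +-mono-≤ (δ-nonneg s z) (δ-nonneg v z)
    degE≡2 : deg G E ≡ + 2
    degE≡2 = trans (Σℤ-distrib-+ n (δ s) (δ v)) (cong₂ _+_ (Σℤ-δ n s) (Σℤ-δ n v))
    D' : Divisor G
    D' z = D z - E z
    D'≤1 : ∀ z → D' z ≤ + 1
    D'≤1 z = ≤-trans (0≤j⇒i-j≤i (D z) (E≥0 z)) (D≤1 z)
    D's<0 : D' s < + 0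
    D's<0 rewrite Ds≡0 | δ-self s | δ-other s≢v = -<+
    D'v≤0 : D' v ≤ + 0
    D'v≤0 rewrite δ-other (s≢v ∘ ≡-sym) | δ-self v = i≤j⇒i-j≤0 (D≤1 v)

  mfgonCandidate⇒deg≥ : ∀ {a} → IsIndependenceNumber G a → ∀ D → MfgonCandidate G D →
                        + (n ∸ a) ≤ deg G D
  mfgonCandidate⇒deg≥ {a} (_ , maximal) D (D≥0 , D≤1 , _ , isRank , 0<rk) =
    subst (+ (n ∸ a) ≤_) (≡-sym degD) (+≤+ (ℕ.∸-monoʳ-≤ n (maximal (zeros D) zeros-independent)))
    where
    zeros-independent : Independent G (zeros D)
    zeros-independent =
      RankAtLeast1⇒zeros-independent D≤1 (positiveRank⇒RankAtLeast1 G D v isRank 0<rk)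
    degD : deg G D ≡ + (n ∸ ∣ zeros D ∣)
    degD = trans (Σℤ-cong n (01-valued≡𝟙∁zeros D D≥0 D≤1)) (deg-𝟙∁ (zeros D))

  𝟙∁-RankAtLeast1 : ∀ {S} → Independent G S → v ∉ S → RankAtLeast G (𝟙 (∁ S)) 1
  𝟙∁-RankAtLeast1 {S} S-indep v∉S E E≥0 degE≡1 =
    let w , E≡δ = effective-deg1⇒δ n E E≥0 degE≡1 in
    EquivEffective-cong G (λ z → cong (_-_ (𝟙 (∁ S) z)) (≡-sym (E≡δ z))) (lower w (w ∈? S))
    where
    lower : ∀ w → Dec (w ∈ S) → EquivEffective G (λ z → 𝟙 (∁ S) z - δ w z)
    lower w (no w∉S) = effective⇒equivEffective G nonneg
      where
      nonneg : ∀ z → + 0 ≤ 𝟙 (∁ S) z - δ w z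
      nonneg z with z ≟ w
      ... | yes refl rewrite 𝟙-∈ (x∉p⇒x∈∁p w∉S) | δ-self w = ≤-refl
      ... | no  z≢w  rewrite δ-other z≢w | +-identityʳ (𝟙 (∁ S) z) = 𝟙-nonneg (∁ S) z
    lower w (yes w∈S) = Lap≤⇒equivEffective G (λ y → - δ w y) bound
      where
      w≢v : w ≢ v
      w≢v refl = v∉S w∈S
      bound : ∀ z → Lap G (λ y → - δ w y) z ≤ 𝟙 (∁ S) z - δ w z
      bound z with z ≟ w
      ... | yes refl = ≤-trans (Lap-borrow-self G (adj-v w≢v)) (≤-reflexive (≡-sym at-w))
        where
        at-w : 𝟙 (∁ S) w - δ w w ≡ -[1+ 0 ]
        at-w rewrite 𝟙-∉ (x∈p⇒x∉∁p w∈S) | δ-self w = refl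
      ... | no  z≢w  =
        ≤-trans (Lap-borrow-other G z≢w)
                (≤-trans (adj-w≤𝟙∁ (z ∈? S)) (≤-reflexive (≡-sym at-z)))
        where
        adj-w≤𝟙∁ : Dec (z ∈ S) → b2ℤ (adj G z w) ≤ 𝟙 (∁ S) z
        adj-w≤𝟙∁ (yes z∈S) rewrite S-indep z w z∈S w∈S = 𝟙-nonneg (∁ S) z
        adj-w≤𝟙∁ (no  z∉S) rewrite 𝟙-∈ (x∉p⇒x∈∁p z∉S) = b2ℤ≤1 _
        at-z : 𝟙 (∁ S) z - δ w z ≡ 𝟙 (∁ S) z
        at-z rewrite δ-other z≢w = +-identityʳ (𝟙 (∁ S) z)

  𝟙∁-rank1 : ∀ {S s} → Independent G S → v ∉ S → s ∈ S → IsRank G (𝟙 (∁ S)) (+ 1)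
  𝟙∁-rank1 {S} {s} S-indep v∉S s∈S =
    inj₂ (effective⇒equivEffective G (𝟙-nonneg (∁ S)) , 1 , refl ,
          𝟙∁-RankAtLeast1 S-indep v∉S , ¬RankAtLeast2 (𝟙≤1 (∁ S)) s≢v (𝟙-∉ (x∈p⇒x∉∁p s∈S)))
    where
    s≢v : s ≢ v
    s≢v refl = v∉S s∈S

  maxIndependent-avoiding-v : ∀ {a} → IsIndependenceNumber G a →
                              Σ (Subset n) λ S → Independent G S × ∣ S ∣ ≡ a × v ∉ S × Nonempty S
  maxIndependent-avoiding-v {a} ((S , S-indep , ∣S∣≡a) , maximal) = choose (v ∈? S)
    where
    u = proj₁ (proj₁ connected)
    u≢v = proj₂ (proj₁ connected)

    1≤a : 1 ℕ.≤ a
    1≤a = subst (ℕ._≤ a) (∣⁅x⁆∣≡1 u) (maximal ⁅ u ⁆ (Independent-⁅⁆ G u))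

    choose : Dec (v ∈ S) → Σ (Subset n) λ S → Independent G S × ∣ S ∣ ≡ a × v ∉ S × Nonempty S
    choose (no v∉S) =
      S , S-indep , ∣S∣≡a , v∉S , 1≤∣S∣⇒nonempty S (subst (1 ℕ.≤_) (≡-sym ∣S∣≡a) 1≤a)
    choose (yes v∈S) =
      ⁅ u ⁆ , Independent-⁅⁆ G u , trans (∣⁅x⁆∣≡1 u) (ℕ.≤-antisym 1≤a a≤1) ,
      (u≢v ∘ ≡-sym ∘ x∈⁅y⁆⇒x≡y u) , u , x∈⁅x⁆ u
      where
      S⊆⁅v⁆ : S ⊆ ⁅ v ⁆
      S⊆⁅v⁆ {x} x∈S with x ≟ v
      ... | yes refl = x∈⁅x⁆ v
      ... | no  x≢v  with () ← trans (≡-sym (universal x x≢v)) (S-indep v x v∈S x∈S)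
      a≤1 : a ℕ.≤ 1
      a≤1 = subst₂ ℕ._≤_ ∣S∣≡a (∣⁅x⁆∣≡1 v) (p⊆q⇒∣p∣≤∣q∣ S⊆⁅v⁆)

lemma5p3 : (n : ℕ) (G : SimpleGraph n) (v : Fin n) →
           Connected G → Universal G v → ConnectedMinus G v →
           (a : ℕ) → IsIndependenceNumber G a → IsMfgon G (n ∸ a)
lemma5p3 n G v _ universal connected a α =
  let S , S-indep , ∣S∣≡a , v∉S , s , s∈S = maxIndependent-avoiding-v universal connected α in
  (𝟙 (∁ S) ,
   (𝟙-nonneg (∁ S) , 𝟙≤1 (∁ S) , + 1 , 𝟙∁-rank1 universal connected S-indep v∉S s∈S ,
    +<+ (ℕ.s≤s ℕ.z≤n)) ,
   trans (deg-𝟙∁ S) (cong (λ k → + (n ∸ k)) ∣S∣≡a)) ,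
  mfgonCandidate⇒deg≥ universal connected α
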